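{- Let $b\geq2$ and $t\geq1$ be integers. Let $T$ be a tree of diameter $4t+1$ with exactly $b$ leaves and maximum matching number $bt+1$. Then $T$ is isomorphic to the crab graph $CG_{b_1,b-b_1;2t}$ for some integer $b_1\in\{1,2,\dots,b-1\}$.
   Context: Leaves are vertices of degree $1$; the diameter is the maximum distance between two vertices; the maximum matching number is the largest number of pairwise vertex-disjoint edges. For integers $b_1,b_2,r\geq1$, the crab graph $CG_{b_1,b_2;r}$ consists of an edge $u_0v_0$ together with $b_1$ paths of length $r$ (number of edges) each having $u_0$ as an endpoint and $b_2$ paths of length $r$ each having $v_0$ as an endpoint, these paths otherwise vertex-disjoint. -}

module Defs where

open import Data.Nat using (ℕ; zero; suc; _+_; _*_; _∸_; _≤_; _≟_)
open import Data.Bool using (Bool; true; false; if_then_else_)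
open import Data.Fin using (Fin; toℕ) renaming (zero to fzero; suc to fsuc)
open import Data.List using (List; []; _∷_; length; concatMap; _∷ʳ_)
open import Data.List.Relation.Unary.All using (All)
open import Data.List.Relation.Unary.Linked using (Linked)
open import Data.List.Relation.Unary.Unique.Propositional using (Unique)
open import Data.Product using (Σ; ∃; _×_; _,_; proj₁; proj₂)
open import Data.Sum using (_⊎_)
open import Data.Empty using (⊥)
open import Relation.Nullary using (¬_)
open import Relation.Nullary.Decidable using (⌊_⌋)
open import Relation.Binary.PropositionalEquality using (_≡_)
open import Function using (_∘_; _⇔_; _↔_; Inverse)

record SimpleGraph : Set where
  field
    n     : ℕ
    adj   : Fin n → Fin n → Bool
    sym   : ∀ u v → adj u v ≡ adj v u
    irrefl : ∀ v → adj v v ≡ false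
open SimpleGraph public

Adj : (G : SimpleGraph) → Fin (n G) → Fin (n G) → Set
Adj G u v = adj G u v ≡ true

countB : ∀ {k} → (Fin k → Bool) → ℕ
countB {zero}  f = 0
countB {suc k} f = (if f fzero then 1 else 0) + countB (f ∘ fsuc)

degree : (G : SimpleGraph) → Fin (n G) → ℕ
degree G v = countB (adj G v)

numLeaves : SimpleGraph → ℕ
numLeaves G = countB (λ v → ⌊ degree G v ≟ 1 ⌋)

data Walk (G : SimpleGraph) : Fin (n G) → Fin (n G) → ℕ → Set where
  nil  : ∀ {v} → Walk G v v 0
  cons : ∀ {u w v k} → Adj G u w → Walk G w v k → Walk G u v (suc k)

Connected : SimpleGraph → Set
Connected G = ∀ u v → ∃ λ k → Walk G u v k

IsCycle : (G : SimpleGraph) → List (Fin (n G)) → Set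
IsCycle G []       = ⊥
IsCycle G (v ∷ ws) =
  (3 ≤ length (v ∷ ws)) × Unique (v ∷ ws) × Linked (Adj G) ((v ∷ ws) ∷ʳ v)

Acyclic : SimpleGraph → Set
Acyclic G = ∀ vs → ¬ IsCycle G vs

IsTree : SimpleGraph → Set
IsTree G = Connected G × Acyclic G

Dist : (G : SimpleGraph) → Fin (n G) → Fin (n G) → ℕ → Set
Dist G u v d = Walk G u v d × (∀ k → Walk G u v k → d ≤ k)

Diameter : SimpleGraph → ℕ → Set
Diameter G D =
  (∃ λ u → ∃ λ v → Dist G u v D) ×
  (∀ u v d → Dist G u v d → d ≤ D)

IsMatching : (G : SimpleGraph) → List (Fin (n G) × Fin (n G)) → Set
IsMatching G M =
  All (λ e → Adj G (proj₁ e) (proj₂ e)) M ×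
  Unique (concatMap (λ e → proj₁ e ∷ proj₂ e ∷ []) M)

MatchingNumber : SimpleGraph → ℕ → Set
MatchingNumber G m =
  (∃ λ M → IsMatching G M × length M ≡ m) ×
  (∀ M → IsMatching G M → length M ≤ m)

-- Crab graph CG_{b1,b2;r}.  Vertices: u0, v0, and
-- leftV i k  (i-th path at u0, vertex at distance k+1 from u0),
-- rightV j k (j-th path at v0, vertex at distance k+1 from v0).
data CrabV (b1 b2 r : ℕ) : Set where
  u0 v0  : CrabV b1 b2 r
  leftV  : Fin b1 → Fin r → CrabV b1 b2 r
  rightV : Fin b2 → Fin r → CrabV b1 b2 r

data CrabE {b1 b2 r : ℕ} : CrabV b1 b2 r → CrabV b1 b2 r → Set where
  e-uv  : CrabE u0 v0
  e-u   : ∀ i k → toℕ k ≡ 0 → CrabE u0 (leftV i k)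
  e-v   : ∀ j k → toℕ k ≡ 0 → CrabE v0 (rightV j k)
  e-l   : ∀ i k k' → toℕ k' ≡ suc (toℕ k) → CrabE (leftV i k) (leftV i k')
  e-r   : ∀ j k k' → toℕ k' ≡ suc (toℕ k) → CrabE (rightV j k) (rightV j k')

CrabAdj : (b1 b2 r : ℕ) → CrabV b1 b2 r → CrabV b1 b2 r → Set
CrabAdj b1 b2 r x y = CrabE x y ⊎ CrabE y x

IsoCrab : SimpleGraph → (b1 b2 r : ℕ) → Set
IsoCrab G b1 b2 r =
  Σ (Fin (n G) ↔ CrabV b1 b2 r) λ f →
    ∀ x y → Adj G x y ⇔ CrabAdj b1 b2 r (Inverse.to f x) (Inverse.to f y)

{-# OPTIONS --safe #-}
-- Root the tree at the vertex a at distance r from the end u of a diametral path u … v of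
-- length 2r + 1, and let a′ be the neighbour of a towards v.  A walk entering the branch at a′
-- from outside passes through a, so the diameter bounds the depth by r off that branch and by
-- r + 1 on it.  Hence every vertex lies on the path from a to some leaf, and sending the vertex
-- of depth d above a leaf to position d on the leg of that leaf embeds the tree into a crab
-- with one leg of length r per leaf, attached at a or at a′ according to the side of the leaf.
-- A matching with bt + 1 edges (r = 2t) has 2 + br distinct endpoints, as many vertices as the
-- crab has, so the embedding is onto; it maps parent–child pairs to crab edges and back.
module Submission where

open import Defs hiding (sym)
open import Data.Bool using (Bool; true; false; _∧_; not)
import Data.Bool as Bool
open import Data.Empty using (⊥)
open import Data.Fin using (Fin; toℕ; fromℕ<) renaming (zero to fzero; suc to fsuc)
import Data.Fin as Fin
import Data.Fin.Properties as Finₚ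
open import Data.List using (List; []; _∷_; _∷ʳ_; length; lookup; concatMap)
open import Data.List.Membership.Propositional.Properties using (∈-lookup)
open import Data.List.Properties using (length-++)
open import Data.List.Relation.Unary.All using (All; []; _∷_)
import Data.List.Relation.Unary.All as All
import Data.List.Relation.Unary.All.Properties as Allₚ
open import Data.List.Relation.Unary.AllPairs using ([]; _∷_)
import Data.List.Relation.Unary.AllPairs.Properties as AllPairsₚ
open import Data.List.Relation.Unary.Linked using (Linked; []; [-]; _∷_)
open import Data.List.Relation.Unary.Unique.Propositional using (Unique)
open import Data.Nat using (ℕ; zero; suc; _+_; _*_; _∸_; _≤_; _<_; z≤n; s≤s; _≟_)
open import Data.Nat.Properties hiding (_≟_)
open import Data.Nat.Solver using (module +-*-Solver)
open import Data.Product using (Σ; ∃; ∃₂; _×_; _,_; proj₁; proj₂; map; map₂)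
open import Data.Sum using (_⊎_; inj₁; inj₂)
import Data.Sum as Sum
open import Data.Sum.Function.Propositional using (_⊎-↔_)
import Data.Vec.Functional as Vector
open import Function using (_∘_; id; Injective; _↔_; mk↔ₛ′; mk⇔)
open import Function.Bundles using (Injection)
open import Function.Properties.Inverse using (↔-refl; ↔-sym; ↔-trans; ↔⇒↣)
open import Relation.Binary.Definitions using (tri<; tri≈; tri>)
open import Relation.Binary.PropositionalEquality
open import Relation.Nullary using (¬_; Dec; yes; no; contradiction; _×-dec_)
open import Relation.Nullary.Decidable using (⌊_⌋; isYes≗does; dec-true; dec-false)
open import Relation.Unary using (Decidable)

open +-*-Solver using (solve; _:+_; _:*_; _:=_; con)

least : ∀ {P : ℕ → Set} → Decidable P → ∀ {k} → P k → ∃ λ d → P d × (∀ j → P j → d ≤ j)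
least         P? {zero}  p = 0 , p , λ _ _ → z≤n
least         P? {suc k} p with P? 0 | least (P? ∘ suc) p
... | yes p₀ | _            = 0 , p₀ , λ _ _ → z≤n
... | no ¬p₀ | d , pd , min = suc d , pd , λ where
  zero    p₀ → contradiction p₀ ¬p₀
  (suc j) pj → s≤s (min j pj)

isYes-true : ∀ {A : Set} (a? : Dec A) → A → ⌊ a? ⌋ ≡ true
isYes-true a? a = trans (isYes≗does a?) (dec-true a? a)

isYes-false : ∀ {A : Set} (a? : Dec A) → ¬ A → ⌊ a? ⌋ ≡ false
isYes-false a? ¬a = trans (isYes≗does a?) (dec-false a? ¬a)

injective⇒surjective : ∀ {m k} (g : Fin m → Fin k) → Injective _≡_ _≡_ g → k ≤ m →
                       ∀ c → ∃ λ x → g x ≡ c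
injective⇒surjective {m} {k} g g-injective k≤m c with Finₚ.any? (λ x → g x Fin.≟ c)
... | yes hit = hit
... | no miss = contradiction (≤-trans (Finₚ.injective⇒≤ c∷g-injective) k≤m) 1+n≰n
  where
  c∷g : Fin (suc m) → Fin k
  c∷g = c Vector.∷ g
  c∷g-injective : Injective _≡_ _≡_ c∷g
  c∷g-injective {fzero}  {fzero}  _  = refl
  c∷g-injective {fzero}  {fsuc y} eq = contradiction (y , sym eq) miss
  c∷g-injective {fsuc x} {fzero}  eq = contradiction (x , eq) miss
  c∷g-injective {fsuc x} {fsuc y} eq = cong fsuc (g-injective eq)

leg-position : ∀ {r} o {d} → suc o ≤ d → d ≤ o + r → Σ (Fin r) λ k → suc (o + toℕ k) ≡ d
leg-position zero    {suc d} _         d<r         = fromℕ< d<r , cong suc (Finₚ.toℕ-fromℕ< d<r)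
leg-position (suc o) {suc d} (s≤s o<d) (s≤s d≤o+r) = map₂ (cong suc) (leg-position o o<d d≤o+r)

lookup-injective : ∀ {A : Set} {xs : List A} → Unique xs → Injective _≡_ _≡_ (lookup xs)
lookup-injective {xs = _ ∷ _}  (_ ∷ _)   {fzero}  {fzero}  _  = refl
lookup-injective {xs = _ ∷ xs} (x∉ ∷ _)  {fzero}  {fsuc j} eq =
  contradiction eq (All.lookup x∉ (∈-lookup j))
lookup-injective {xs = _ ∷ xs} (x∉ ∷ _)  {fsuc i} {fzero}  eq =
  contradiction (sym eq) (All.lookup x∉ (∈-lookup i))
lookup-injective               (_ ∷ xs!) {fsuc i} {fsuc j} eq = cong fsuc (lookup-injective xs! eq)

Unique⇒length≤ : ∀ {m} {xs : List (Fin m)} → Unique xs → length xs ≤ m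
Unique⇒length≤ xs! = Finₚ.injective⇒≤ (lookup-injective xs!)

Unique-∷ʳ⁺ : ∀ {A : Set} {xs : List A} {y} → Unique xs → All (_≢ y) xs → Unique (xs ∷ʳ y)
Unique-∷ʳ⁺ xs! xs≢y = AllPairsₚ.++⁺ xs! ([] ∷ []) (All.map (_∷ []) xs≢y)

Linked-∷ʳ⁺ : ∀ {A : Set} {R : A → A → Set} xs {y z} →
             Linked R (xs ∷ʳ y) → R y z → Linked R (xs ∷ʳ y ∷ʳ z)
Linked-∷ʳ⁺ []           _         Ryz = Ryz ∷ [-]
Linked-∷ʳ⁺ (_ ∷ [])     (R ∷ [-]) Ryz = R ∷ Ryz ∷ [-]
Linked-∷ʳ⁺ (_ ∷ x ∷ xs) (R ∷ Rs)  Ryz = R ∷ Linked-∷ʳ⁺ (x ∷ xs) Rs Ryz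

countB-split : ∀ {k} (f g : Fin k → Bool) →
               countB f ≡ countB (λ x → f x ∧ not (g x)) + countB (λ x → f x ∧ g x)
countB-split {zero}  f g = refl
countB-split {suc k} f g with f fzero | g fzero
... | false | _     = countB-split (f ∘ fsuc) (g ∘ fsuc)
... | true  | false = cong suc (countB-split (f ∘ fsuc) (g ∘ fsuc))
... | true  | true  = trans (cong suc (countB-split (f ∘ fsuc) (g ∘ fsuc))) (sym (+-suc _ _))

countB≢0 : ∀ {k} (f : Fin k → Bool) → countB f ≢ 0 → ∃ λ x → f x ≡ true
countB≢0 {zero}  f ≢0 = contradiction refl ≢0
countB≢0 {suc k} f ≢0 with f fzero in f₀
... | true  = fzero , f₀
... | false = map fsuc id (countB≢0 (f ∘ fsuc) ≢0)

countB≢1 : ∀ {k} (f : Fin k → Bool) {p} → f p ≡ true → countB f ≢ 1 →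
           ∃ λ x → f x ≡ true × x ≢ p
countB≢1 {suc k} f {fzero} fp ≢1 with f fzero | fp
... | true | refl = map fsuc (λ fx → fx , λ ()) (countB≢0 (f ∘ fsuc) (≢1 ∘ cong suc))
countB≢1 {suc k} f {fsuc p} fp ≢1 with f fzero in f₀
... | true  = fzero , f₀ , λ ()
... | false = map fsuc (map₂ (_∘ Finₚ.suc-injective)) (countB≢1 (f ∘ fsuc) fp ≢1)

enumerate : ∀ {k} (f : Fin k → Bool) →
            Σ (Fin (countB f) → Fin k) λ sel → ∀ x → f x ≡ true → ∃ λ i → sel i ≡ x
enumerate {zero}  f = (λ ()) , λ ()
enumerate {suc k} f with f fzero in f₀ | enumerate (f ∘ fsuc)
... | true  | sel , hit = fzero Vector.∷ (fsuc ∘ sel) , λ where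
  fzero    _  → fzero , refl
  (fsuc x) fx → map fsuc (cong fsuc) (hit x fx)
... | false | sel , hit = fsuc ∘ sel , λ where
  fzero    fx → contradiction (trans (sym f₀) fx) λ ()
  (fsuc x) fx → map₂ (cong fsuc) (hit x fx)

crabV↔⊎ : ∀ {b₁ b₂ r} → CrabV b₁ b₂ r ↔ (Fin 2 ⊎ ((Fin b₁ × Fin r) ⊎ (Fin b₂ × Fin r)))
crabV↔⊎ {b₁} {b₂} {r} = mk↔ₛ′ to from to∘from from∘to
  where
  Code : Set
  Code = Fin 2 ⊎ ((Fin b₁ × Fin r) ⊎ (Fin b₂ × Fin r))
  to : CrabV b₁ b₂ r → Code
  to u0           = inj₁ fzero
  to v0           = inj₁ (fsuc fzero)
  to (leftV i k)  = inj₂ (inj₁ (i , k))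
  to (rightV j k) = inj₂ (inj₂ (j , k))
  from : Code → CrabV b₁ b₂ r
  from (inj₁ fzero)          = u0
  from (inj₁ (fsuc fzero))   = v0
  from (inj₂ (inj₁ (i , k))) = leftV i k
  from (inj₂ (inj₂ (j , k))) = rightV j k
  to∘from : ∀ c → to (from c) ≡ c
  to∘from (inj₁ fzero)        = refl
  to∘from (inj₁ (fsuc fzero)) = refl
  to∘from (inj₂ (inj₁ _))     = refl
  to∘from (inj₂ (inj₂ _))     = refl
  from∘to : ∀ c → from (to c) ≡ c
  from∘to u0           = refl
  from∘to v0           = refl
  from∘to (leftV _ _)  = refl
  from∘to (rightV _ _) = refl

crabV↔Fin : ∀ {b₁ b₂ r} → CrabV b₁ b₂ r ↔ Fin (2 + (b₁ * r + b₂ * r))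
crabV↔Fin = ↔-trans crabV↔⊎
  (↔-sym (↔-trans Finₚ.+↔⊎ (↔-refl ⊎-↔ ↔-trans Finₚ.+↔⊎ (Finₚ.*↔× ⊎-↔ Finₚ.*↔×))))

module Walks (G : SimpleGraph) where

  V : Set
  V = Fin (n G)

  adj-sym : ∀ {x y} → Adj G x y → Adj G y x
  adj-sym {x} {y} xy = trans (SimpleGraph.sym G y x) xy

  adj⇒≢ : ∀ {x y} → Adj G x y → x ≢ y
  adj⇒≢ {x} xy refl = contradiction (trans (sym xy) (irrefl G x)) λ ()

  _++ʷ_ : ∀ {x y z j k} → Walk G x y j → Walk G y z k → Walk G x z (j + k)
  nil       ++ʷ q = q
  cons xy p ++ʷ q = cons xy (p ++ʷ q)

  reverseʷ : ∀ {x y k} → Walk G x y k → Walk G y x k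
  reverseʷ nil                 = nil
  reverseʷ (cons {k = k} xy p) =
    subst (Walk G _ _) (+-comm k 1) (reverseʷ p ++ʷ cons (adj-sym xy) nil)

  splitʷ : ∀ j {k x z} → Walk G x z (j + k) → ∃ λ y → Walk G x y j × Walk G y z k
  splitʷ zero    p           = _ , nil , p
  splitʷ (suc j) (cons xy p) with y , p₁ , p₂ ← splitʷ j p = y , cons xy p₁ , p₂

  walk? : ∀ x y k → Dec (Walk G x y k)
  walk? x y zero with x Fin.≟ y
  ... | yes refl = yes nil
  ... | no  x≢y  = no λ { nil → x≢y refl }
  walk? x y (suc k) with Finₚ.any? (λ w → (adj G x w Bool.≟ true) ×-dec walk? w y k)
  ... | yes (w , xw , p) = yes (cons xw p)
  ... | no  none         = no λ { (cons xw p) → none (_ , xw , p) }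

  distance : Connected G → ∀ x y → ∃ (Dist G x y)
  distance connected x y = least (walk? x y) (proj₂ (connected x y))

module RootedTree (G : SimpleGraph) (acyclic : Acyclic G) (root : Fin (n G))
                  (geodesic : ∀ x → ∃ (Dist G x root)) where

  open Walks G public

  depth : V → ℕ
  depth x = proj₁ (geodesic x)

  depth-walk : ∀ x → Walk G x root (depth x)
  depth-walk x = proj₁ (proj₂ (geodesic x))

  depth-min : ∀ {x k} → Walk G x root k → depth x ≤ k
  depth-min {x} {k} = proj₂ (proj₂ (geodesic x)) k

  depth-root : depth root ≡ 0
  depth-root = n≤0⇒n≡0 (depth-min nil)

  depth≡0 : ∀ {x} → depth x ≡ 0 → x ≡ root
  depth≡0 {x} d≡0 with nil ← subst (Walk G x root) d≡0 (depth-walk x) = refl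

  1≤depth⇒≢root : ∀ {x} → 1 ≤ depth x → x ≢ root
  1≤depth⇒≢root 1≤dx refl = contradiction depth-root (m<n⇒n≢0 1≤dx)

  root-or-deep : ∀ x → x ≡ root ⊎ 1 ≤ depth x
  root-or-deep x with depth x in dx
  ... | zero  = inj₁ (depth≡0 dx)
  ... | suc _ = inj₂ (s≤s z≤n)

  ≢root⇒1≤depth : ∀ {x} → x ≢ root → 1 ≤ depth x
  ≢root⇒1≤depth {x} x≢root with root-or-deep x
  ... | inj₁ x≡root = contradiction x≡root x≢root
  ... | inj₂ 1≤dx   = 1≤dx

  depth-walk≤ : ∀ {x y k} → Walk G x y k → depth y ≤ depth x + k
  depth-walk≤ {x} {y} {k} p =
    subst (depth y ≤_) (+-comm k (depth x)) (depth-min (reverseʷ p ++ʷ depth-walk x))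

  depth-adj : ∀ {x y} → Adj G x y → depth x ≤ suc (depth y)
  depth-adj xy = depth-min (cons xy (depth-walk _))

  second : ∀ {x y k} → Walk G x y k → V
  second {x} nil            = x
  second (cons {w = w} _ _) = w

  second-spec : ∀ {x y d k} (p : Walk G x y d) → d ≡ suc k →
                Adj G x (second p) × Walk G (second p) y k
  second-spec (cons xw p) refl = xw , p

  parent : V → V
  parent x = second (depth-walk x)

  parent-spec : ∀ {x k} → depth x ≡ suc k → Adj G x (parent x) × depth (parent x) ≡ k
  parent-spec {x} dx with xp , p ← second-spec (depth-walk x) dx =
    xp , ≤-antisym (depth-min p) (≤-pred (subst (_≤ suc (depth (parent x))) dx (depth-adj xp)))

  parent-depth : ∀ {x} → 1 ≤ depth x → Adj G x (parent x) × depth (parent x) ≡ depth x ∸ 1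
  parent-depth {x} 1≤dx = parent-spec (trans (sym (m∸n+n≡m 1≤dx)) (+-comm (depth x ∸ 1) 1))

  infix 4 _⋖_ _≼_

  _⋖_ : V → V → Set
  p ⋖ c = depth c ≡ suc (depth p) × parent c ≡ p

  parent-⋖ : ∀ {x k} → depth x ≡ suc k → parent x ⋖ x
  parent-⋖ dx = trans dx (cong suc (sym (proj₂ (parent-spec dx)))) , refl

  root-⋖ : ∀ {x} → depth x ≡ 1 → root ⋖ x
  root-⋖ dx = subst (_⋖ _) (depth≡0 (proj₂ (parent-spec dx))) (parent-⋖ dx)

  ⋖⇒adj : ∀ {p c} → p ⋖ c → Adj G p c
  ⋖⇒adj (dc , refl) = adj-sym (proj₁ (parent-spec dc))

  ⋖⇒1≤depth : ∀ {p c} → p ⋖ c → 1 ≤ depth c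
  ⋖⇒1≤depth (dc , _) = subst (1 ≤_) (sym dc) (s≤s z≤n)

  ⋖⇒≢root : ∀ {p c} → p ⋖ c → c ≢ root
  ⋖⇒≢root = 1≤depth⇒≢root ∘ ⋖⇒1≤depth

  Path : List V → Set
  Path xs = Unique xs × Linked (Adj G) xs

  -- Stepping to the parents at both ends either closes a cycle (equal parents) or gives an
  -- arc of the same kind one level higher; at the root level the two ends coincide.
  no-arc : ∀ k {x y} mid → depth x ≡ k → depth y ≡ k → x ≢ y →
           All (λ z → k ≤ depth z) mid → ¬ Path ((x ∷ mid) ∷ʳ y)
  no-arc zero    mid dx dy x≢y _ _ = x≢y (trans (depth≡0 dx) (sym (depth≡0 dy)))
  no-arc (suc k) {x} {y} mid dx dy x≢y deep (arc! , arc) = climb (parent x Fin.≟ parent y)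
    where
    arc-deep : All (λ z → suc k ≤ depth z) ((x ∷ mid) ∷ʳ y)
    arc-deep = Allₚ.∷ʳ⁺ (≤-reflexive (sym dx) ∷ deep) (≤-reflexive (sym dy))
    ∉arc : ∀ {w} → depth w ≡ k → All (w ≢_) ((x ∷ mid) ∷ʳ y)
    ∉arc dw = All.map (λ k<dz w≡z → <⇒≢ (subst (_< _) (sym dw) k<dz) (cong depth w≡z)) arc-deep
    x↑ : Adj G x (parent x)
    x↑ = proj₁ (parent-spec dx)
    y↑ : Adj G y (parent y)
    y↑ = proj₁ (parent-spec dy)
    px∉ : All (parent x ≢_) ((x ∷ mid) ∷ʳ y)
    px∉ = ∉arc (proj₂ (parent-spec dx))
    py∉ : All (parent y ≢_) ((x ∷ mid) ∷ʳ y)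
    py∉ = ∉arc (proj₂ (parent-spec dy))
    climb : Dec (parent x ≡ parent y) → ⊥
    climb (yes px≡py) = acyclic (parent x ∷ (x ∷ mid) ∷ʳ y)
      ( s≤s (s≤s (subst (1 ≤_) (sym (length-++ mid)) (m≤n+m 1 (length mid))))
      , px∉ ∷ arc!
      , adj-sym x↑ ∷ Linked-∷ʳ⁺ (x ∷ mid) arc (subst (Adj G y) (sym px≡py) y↑))
    climb (no px≢py) =
      no-arc k ((x ∷ mid) ∷ʳ y) (proj₂ (parent-spec dx)) (proj₂ (parent-spec dy)) px≢py
        (All.map <⇒≤ arc-deep)
        ( Unique-∷ʳ⁺ (px∉ ∷ arc!) (px≢py ∷ All.map (_∘ sym) py∉)
        , Linked-∷ʳ⁺ (parent x ∷ x ∷ mid) (adj-sym x↑ ∷ arc) y↑)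

  adj⇒depth≢ : ∀ {x y} → Adj G x y → depth x ≢ depth y
  adj⇒depth≢ {x} xy dx≡dy = no-arc (depth x) [] refl (sym dx≡dy) (adj⇒≢ xy) []
    ((adj⇒≢ xy ∷ []) ∷ [] ∷ [] , xy ∷ [-])

  adj-below⇒parent : ∀ {x y} → depth x ≡ suc (depth y) → Adj G x y → parent x ≡ y
  adj-below⇒parent {x} {y} dx xy with parent-spec dx
  ... | x↑ , dpx with y Fin.≟ parent x
  ...   | yes y≡px = sym y≡px
  ...   | no  y≢px = contradiction (y-x-px! , adj-sym xy ∷ x↑ ∷ [-])
                       (no-arc (depth y) (x ∷ []) refl dpx y≢px (dy≤dx ∷ []))
    where
    y-x-px! : Unique (y ∷ x ∷ parent x ∷ [])
    y-x-px! = (adj⇒≢ (adj-sym xy) ∷ y≢px ∷ []) ∷ (adj⇒≢ x↑ ∷ []) ∷ [] ∷ []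
    dy≤dx : depth y ≤ depth x
    dy≤dx = ≤-trans (n≤1+n _) (≤-reflexive (sym dx))

  adj⇒⋖ : ∀ {x y} → Adj G x y → x ⋖ y ⊎ y ⋖ x
  adj⇒⋖ {x} {y} xy with <-cmp (depth x) (depth y)
  ... | tri≈ _ dx≡dy _ = contradiction dx≡dy (adj⇒depth≢ xy)
  ... | tri< dx<dy _ _ = inj₁ (dy , adj-below⇒parent dy (adj-sym xy))
    where
    dy : depth y ≡ suc (depth x)
    dy = ≤-antisym (depth-adj (adj-sym xy)) dx<dy
  ... | tri> _ _ dy<dx = inj₂ (dx , adj-below⇒parent dx xy)
    where
    dx : depth x ≡ suc (depth y)
    dx = ≤-antisym (depth-adj xy) dy<dx

  up : ℕ → V → V
  up zero    x = x
  up (suc k) x = up k (parent x)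

  up-+ : ∀ j k x → up (j + k) x ≡ up k (up j x)
  up-+ zero    k x = refl
  up-+ (suc j) k x = up-+ j k (parent x)

  ≤depth-parent : ∀ {k x} → suc k ≤ depth x → k ≤ depth (parent x)
  ≤depth-parent {k} k<dx =
    subst (k ≤_) (sym (proj₂ (parent-depth (≤-trans (s≤s z≤n) k<dx)))) (∸-monoˡ-≤ 1 k<dx)

  depth-up : ∀ k x → k ≤ depth x → depth (up k x) ≡ depth x ∸ k
  depth-up zero    x _    = refl
  depth-up (suc k) x k<dx = begin
    depth (up k (parent x)) ≡⟨ depth-up k (parent x) (≤depth-parent k<dx) ⟩
    depth (parent x) ∸ k    ≡⟨ cong (_∸ k) (proj₂ (parent-depth (≤-trans (s≤s z≤n) k<dx))) ⟩
    depth x ∸ 1 ∸ k         ≡⟨ ∸-+-assoc (depth x) 1 k ⟩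
    depth x ∸ suc k         ∎
    where open ≡-Reasoning

  walk-up : ∀ k x → k ≤ depth x → Walk G x (up k x) k
  walk-up zero    x _    = nil
  walk-up (suc k) x k<dx =
    cons (proj₁ (parent-depth (≤-trans (s≤s z≤n) k<dx))) (walk-up k (parent x) (≤depth-parent k<dx))

  ancestorAt : ℕ → V → V
  ancestorAt d x = up (depth x ∸ d) x

  depth-ancestorAt : ∀ {d x} → d ≤ depth x → depth (ancestorAt d x) ≡ d
  depth-ancestorAt {d} {x} d≤dx = trans (depth-up (depth x ∸ d) x (m∸n≤m _ d)) (m∸[m∸n]≡n d≤dx)

  ancestorAt-ancestorAt : ∀ {e d x} → e ≤ d → d ≤ depth x →
                          ancestorAt e x ≡ ancestorAt e (ancestorAt d x)
  ancestorAt-ancestorAt {e} {d} {x} e≤d d≤dx = begin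
    up (depth x ∸ e) x                               ≡⟨ cong (λ k → up k x) split ⟩
    up ((depth x ∸ d) + (d ∸ e)) x                   ≡⟨ up-+ (depth x ∸ d) (d ∸ e) x ⟩
    up (d ∸ e) (ancestorAt d x)                      ≡⟨ cong (λ d′ → up (d′ ∸ e) (ancestorAt d x))
                                                             (depth-ancestorAt d≤dx) ⟨
    up (depth (ancestorAt d x) ∸ e) (ancestorAt d x) ∎
    where
    open ≡-Reasoning
    split : depth x ∸ e ≡ (depth x ∸ d) + (d ∸ e)
    split = trans (cong (_∸ e) (sym (m∸n+n≡m d≤dx))) (+-∸-assoc (depth x ∸ d) e≤d)

  _≼_ : V → V → Set
  y ≼ x = depth y ≤ depth x × ancestorAt (depth y) x ≡ y

  ≼⇒ancestorAt : ∀ {d y x} → d ≡ depth y → y ≼ x → ancestorAt d x ≡ y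
  ≼⇒ancestorAt refl (_ , y↑x) = y↑x

  ancestorAt-≼ : ∀ {d x} → d ≤ depth x → ancestorAt d x ≼ x
  ancestorAt-≼ {d} {x} d≤dx = subst (_≤ depth x) (sym dy) d≤dx , cong (λ d′ → ancestorAt d′ x) dy
    where
    dy : depth (ancestorAt d x) ≡ d
    dy = depth-ancestorAt d≤dx

  ≼-refl : ∀ {x} → x ≼ x
  ≼-refl {x} = ≤-refl , cong (λ k → up k x) (n∸n≡0 (depth x))

  ≼-trans : ∀ {z y x} → z ≼ y → y ≼ x → z ≼ x
  ≼-trans {z} (dz≤dy , z↑y) (dy≤dx , y↑x) = ≤-trans dz≤dy dy≤dx ,
    trans (ancestorAt-ancestorAt dz≤dy dy≤dx) (trans (cong (ancestorAt (depth z)) y↑x) z↑y)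

  ≼-unique : ∀ {y z x} → y ≼ x → z ≼ x → depth y ≡ depth z → y ≡ z
  ≼-unique y≼x z≼x dy≡dz = trans (sym (≼⇒ancestorAt refl y≼x)) (≼⇒ancestorAt dy≡dz z≼x)

  ⋖⇒≼ : ∀ {p c} → p ⋖ c → p ≼ c
  ⋖⇒≼ {p} {c} (dc , pc≡p) = subst (depth p ≤_) (sym dc) (n≤1+n _) ,
    trans (cong (λ k → up k c) (trans (cong (_∸ depth p) dc) (m+n∸n≡m 1 (depth p)))) pc≡p

  ≼-⋖ : ∀ {p c x} → p ≼ x → c ≼ x → depth c ≡ suc (depth p) → p ⋖ c
  ≼-⋖ p≼x c≼x dc = dc , ≼-unique (≼-trans (⋖⇒≼ (parent-⋖ dc)) c≼x) p≼x (proj₂ (parent-spec dc))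

  child-exists : ∀ {x} → x ≢ root → degree G x ≢ 1 → ∃ (x ⋖_)
  child-exists {x} x≢root deg≢1
    with y , xy , y≢px ← countB≢1 (adj G x) (proj₁ (parent-depth (≢root⇒1≤depth x≢root))) deg≢1
    with adj⇒⋖ xy
  ... | inj₁ x⋖y        = y , x⋖y
  ... | inj₂ (_ , px≡y) = contradiction (sym px≡y) y≢px

  leaf-below : ∀ {h} → (∀ y → depth y ≤ h) → ∀ {x} → x ≢ root → ∃ λ z → degree G z ≡ 1 × x ≼ z
  leaf-below {h} bounded = descend (suc h) (m≤n+m (suc h) _)
    where
    deeper : ∀ {x c fuel} → x ⋖ c → h < depth x + suc fuel → h < depth c + fuel
    deeper {fuel = fuel} (dc , _) =
      subst (h <_) (trans (+-suc _ fuel) (cong (_+ fuel) (sym dc)))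
    descend : ∀ fuel {x} → h < depth x + fuel → x ≢ root → ∃ λ z → degree G z ≡ 1 × x ≼ z
    descend zero {x} deep _ =
      contradiction (subst (h <_) (+-identityʳ (depth x)) deep) (≤⇒≯ (bounded x))
    descend (suc fuel) {x} deep x≢root with degree G x ≟ 1
    ... | yes leaf = x , leaf , ≼-refl
    ... | no  ¬leaf with c , x⋖c ← child-exists x≢root ¬leaf
      with z , leaf , c≼z ← descend fuel (deeper x⋖c deep) (⋖⇒≢root x⋖c) =
        z , leaf , ≼-trans (⋖⇒≼ x⋖c) c≼z

  branch : V → V
  branch = ancestorAt 1

  branch-root : branch root ≡ root
  branch-root = cong (λ d → up (d ∸ 1) root) depth-root

  depth≡1⇒branch≡ : ∀ {x} → depth x ≡ 1 → branch x ≡ x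
  depth≡1⇒branch≡ {x} dx = cong (λ d → up (d ∸ 1) x) dx

  ≼⇒branch≡ : ∀ {y x} → y ≼ x → 1 ≤ depth y → branch x ≡ branch y
  ≼⇒branch≡ (dy≤dx , y↑x) 1≤dy = trans (ancestorAt-ancestorAt 1≤dy dy≤dx) (cong branch y↑x)

  ⋖⇒branch≡ : ∀ {p c} → p ⋖ c → 1 ≤ depth p → branch c ≡ branch p
  ⋖⇒branch≡ p⋖c = ≼⇒branch≡ (⋖⇒≼ p⋖c)

  branch-⋖ : ∀ {x} → depth x ≡ 2 → branch x ⋖ x
  branch-⋖ dx = ≼-⋖ (ancestorAt-≼ 1≤dx) ≼-refl (trans dx (cong suc (sym (depth-ancestorAt 1≤dx))))
    where
    1≤dx : 1 ≤ depth _
    1≤dx = subst (1 ≤_) (sym dx) (s≤s z≤n)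

  module Branch (top : V) (top≢root : top ≢ root) where

    InBranch : V → Set
    InBranch x = branch x ≡ top

    depth≡1-inside : ∀ {x} → depth x ≡ 1 → InBranch x → x ≡ top
    depth≡1-inside dx x∈ = trans (sym (depth≡1⇒branch≡ dx)) x∈

    leaving-branch : ∀ {x y} → Adj G x y → ¬ InBranch x → InBranch y → x ≡ root
    leaving-branch {x} {y} xy x∉ y∈ with adj⇒⋖ xy | root-or-deep x | root-or-deep y
    ... | _        | inj₁ x≡root | _         = x≡root
    ... | inj₁ x⋖y | inj₂ 1≤dx   | _         = contradiction (trans (sym (⋖⇒branch≡ x⋖y 1≤dx)) y∈) x∉
    ... | inj₂ _   | inj₂ _      | inj₁ refl = contradiction (trans (sym y∈) branch-root) top≢root
    ... | inj₂ y⋖x | inj₂ _      | inj₂ 1≤dy = contradiction (trans (⋖⇒branch≡ y⋖x 1≤dy) y∈) x∉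

    -- The walk crosses into the branch along the edge root–top, so it is at least as long as
    -- the way down from x to the root followed by the way up from the root to y.
    walk-into-branch : ∀ {x y k} → ¬ InBranch x → InBranch y → Walk G x y k → depth x + depth y ≤ k
    walk-into-branch x∉ x∈ nil = contradiction x∈ x∉
    walk-into-branch {x} {y} {suc k} x∉ y∈ (cons {w = w} xw p) with branch w Fin.≟ top
    ... | no  w∉ = ≤-trans (+-monoˡ-≤ (depth y) (depth-adj xw)) (s≤s (walk-into-branch w∉ y∈ p))
    ... | yes w∈ with refl ← leaving-branch xw x∉ w∈ = begin
      depth root + depth y ≡⟨ cong (_+ depth y) depth-root ⟩
      depth y              ≤⟨ depth-walk≤ (cons xw p) ⟩
      depth root + suc k   ≡⟨ cong (_+ suc k) depth-root ⟩
      suc k                ∎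
      where open ≤-Reasoning

module CrabShape (G : SimpleGraph) (connected : Connected G) (acyclic : Acyclic G) (r : ℕ)
                 {u a v : Fin (n G)} (u→a : Walk G u a r) (a→v : Walk G a v (suc r))
                 (long : ∀ k → Walk G u v k → r + suc r ≤ k)
                 (bounded : ∀ x y d → Dist G x y d → d ≤ r + suc r)
                 (many : 2 + numLeaves G * r ≤ n G) where

  open RootedTree G acyclic a (λ x → Walks.distance G connected x a)

  depth-u : depth u ≡ r
  depth-u = ≤-antisym (depth-min u→a)
                      (+-cancelʳ-≤ (suc r) r (depth u) (long _ (depth-walk u ++ʷ a→v)))

  depth-v : depth v ≡ suc r
  depth-v = ≤-antisym (depth-min (reverseʷ a→v))
                      (+-cancelˡ-≤ r (suc r) (depth v) (long _ (u→a ++ʷ reverseʷ (depth-walk v))))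

  a′ : V
  a′ = branch v

  depth-a′ : depth a′ ≡ 1
  depth-a′ = depth-ancestorAt (subst (1 ≤_) (sym depth-v) (s≤s z≤n))

  a′≢a : a′ ≢ a
  a′≢a a′≡a = 0≢1+n (trans (sym depth-root) (trans (cong depth (sym a′≡a)) depth-a′))

  open Branch a′ a′≢a

  a∉ : ¬ InBranch a
  a∉ a∈ = a′≢a (trans (sym a∈) branch-root)

  inside⇒≢a : ∀ {x} → InBranch x → x ≢ a
  inside⇒≢a x∈ refl = a∉ x∈

  u∉ : ¬ InBranch u
  u∉ u∈ = <⇒≱ shortcut (long _ (u→a′ ++ʷ a′→v))
    where
    u→a′ : Walk G u a′ (depth u ∸ 1)
    u→a′ = subst (λ z → Walk G u z _) u∈ (walk-up _ u (m∸n≤m _ 1))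
    a′→v : Walk G a′ v (depth v ∸ 1)
    a′→v = reverseʷ (walk-up _ v (m∸n≤m _ 1))
    shortcut : (depth u ∸ 1) + (depth v ∸ 1) < r + suc r
    shortcut = +-mono-≤-< (subst (λ d → d ∸ 1 ≤ r) (sym depth-u) (m∸n≤m r 1))
                          (≤-reflexive (cong (λ d → suc (d ∸ 1)) depth-v))

  depth-outside : ∀ {x} → ¬ InBranch x → depth x ≤ r
  depth-outside {x} x∉ with d , p , min ← distance connected x v =
    +-cancelʳ-≤ (suc r) (depth x) r (begin
      depth x + suc r   ≡⟨ cong (depth x +_) depth-v ⟨
      depth x + depth v ≤⟨ walk-into-branch x∉ refl p ⟩
      d                 ≤⟨ bounded x v d (p , min) ⟩
      r + suc r         ∎)
    where open ≤-Reasoning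

  depth-inside : ∀ {x} → InBranch x → depth x ≤ suc r
  depth-inside {x} x∈ with d , p , min ← distance connected u x =
    +-cancelˡ-≤ r (depth x) (suc r) (begin
      r + depth x       ≡⟨ cong (_+ depth x) depth-u ⟨
      depth u + depth x ≤⟨ walk-into-branch u∉ x∈ p ⟩
      d                 ≤⟨ bounded u x d (p , min) ⟩
      r + suc r         ∎)
    where open ≤-Reasoning

  depth≤ : ∀ x → depth x ≤ suc r
  depth≤ x with branch x Fin.≟ a′
  ... | yes x∈ = depth-inside x∈
  ... | no  x∉ = m≤n⇒m≤1+n (depth-outside x∉)

  depth-inside≥2 : ∀ {x} → x ≢ a′ → InBranch x → 2 ≤ depth x
  depth-inside≥2 {x} x≢a′ x∈ with m≤n⇒m<n∨m≡n (≢root⇒1≤depth (inside⇒≢a x∈))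
  ... | inj₁ 1<dx = 1<dx
  ... | inj₂ 1≡dx = contradiction (depth≡1-inside (sym 1≡dx) x∈) x≢a′

  position-outside : ∀ {x} → 1 ≤ depth x → ¬ InBranch x → Σ (Fin r) λ k → 1 + toℕ k ≡ depth x
  position-outside 1≤dx x∉ = leg-position 0 1≤dx (depth-outside x∉)

  position-inside : ∀ {x} → 2 ≤ depth x → InBranch x → Σ (Fin r) λ k → 2 + toℕ k ≡ depth x
  position-inside 2≤dx x∈ = leg-position 1 2≤dx (depth-inside x∈)

  leaf? inside? : V → Bool
  leaf?   x = ⌊ degree G x ≟ 1 ⌋
  inside? x = ⌊ branch x Fin.≟ a′ ⌋

  b₁ b₂ : ℕ
  b₁ = countB (λ x → leaf? x ∧ not (inside? x))
  b₂ = countB (λ x → leaf? x ∧ inside? x)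

  numLeaves≡ : numLeaves G ≡ b₁ + b₂
  numLeaves≡ = countB-split leaf? inside?

  leaf-index : ∀ (side? : V → Bool) {x} → x ≢ a → (∀ {z} → x ≼ z → side? z ≡ true) →
               ∃ λ i → x ≼ proj₁ (enumerate (λ z → leaf? z ∧ side? z)) i
  leaf-index side? {x} x≢a on-side with z , leaf , x≼z ← leaf-below depth≤ x≢a =
    map₂ (λ i↦z → subst (x ≼_) (sym i↦z) x≼z)
         (proj₂ (enumerate _) z (cong₂ _∧_ (isYes-true (_ ≟ 1) leaf) (on-side x≼z)))

  leftLeaf : Fin b₁ → V
  leftLeaf = proj₁ (enumerate _)

  rightLeaf : Fin b₂ → V
  rightLeaf = proj₁ (enumerate _)

  left-leaf-below : ∀ {x} → x ≢ a → ¬ InBranch x → ∃ λ i → x ≼ leftLeaf i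
  left-leaf-below {x} x≢a x∉ = leaf-index (not ∘ inside?) x≢a λ x≼z →
    cong not (isYes-false (_ Fin.≟ a′) (x∉ ∘ trans (sym (≼⇒branch≡ x≼z (≢root⇒1≤depth x≢a)))))

  right-leaf-below : ∀ {x} → InBranch x → ∃ λ j → x ≼ rightLeaf j
  right-leaf-below {x} x∈ = leaf-index inside? (inside⇒≢a x∈) λ x≼z →
    isYes-true (_ Fin.≟ a′) (trans (≼⇒branch≡ x≼z (≢root⇒1≤depth (inside⇒≢a x∈))) x∈)

  ψ : CrabV b₁ b₂ r → V
  ψ u0           = a
  ψ v0           = a′
  ψ (leftV i k)  = ancestorAt (1 + toℕ k) (leftLeaf i)
  ψ (rightV j k) = ancestorAt (2 + toℕ k) (rightLeaf j)

  φ : V → CrabV b₁ b₂ r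
  φ x with x Fin.≟ a | x Fin.≟ a′ | branch x Fin.≟ a′
  ... | yes _  | _       | _      = u0
  ... | no _   | yes _   | _      = v0
  ... | no x≢a | no _    | no x∉  = leftV (proj₁ (left-leaf-below x≢a x∉))
                                          (proj₁ (position-outside (≢root⇒1≤depth x≢a) x∉))
  ... | no _   | no x≢a′ | yes x∈ = rightV (proj₁ (right-leaf-below x∈))
                                           (proj₁ (position-inside (depth-inside≥2 x≢a′ x∈) x∈))

  ψ-φ : ∀ x → ψ (φ x) ≡ x
  ψ-φ x with x Fin.≟ a | x Fin.≟ a′ | branch x Fin.≟ a′
  ... | yes x≡a | _        | _      = sym x≡a
  ... | no _    | yes x≡a′ | _      = sym x≡a′
  ... | no x≢a  | no _     | no x∉  =
    ≼⇒ancestorAt (proj₂ (position-outside (≢root⇒1≤depth x≢a) x∉)) (proj₂ (left-leaf-below x≢a x∉))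
  ... | no _    | no x≢a′  | yes x∈ =
    ≼⇒ancestorAt (proj₂ (position-inside (depth-inside≥2 x≢a′ x∈) x∈)) (proj₂ (right-leaf-below x∈))

  φ-leftV⁻¹ : ∀ {x i k} → φ x ≡ leftV i k → 1 + toℕ k ≡ depth x × x ≼ leftLeaf i
  φ-leftV⁻¹ {x} φx≡ with x Fin.≟ a | x Fin.≟ a′ | branch x Fin.≟ a′ | φx≡
  ... | yes _  | _     | _     | ()
  ... | no _   | yes _ | _     | ()
  ... | no x≢a | no _  | no x∉ | refl =
    proj₂ (position-outside (≢root⇒1≤depth x≢a) x∉) , proj₂ (left-leaf-below x≢a x∉)
  ... | no _   | no _  | yes _ | ()

  φ-rightV⁻¹ : ∀ {x j k} → φ x ≡ rightV j k → 2 + toℕ k ≡ depth x × x ≼ rightLeaf j × InBranch x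
  φ-rightV⁻¹ {x} φx≡ with x Fin.≟ a | x Fin.≟ a′ | branch x Fin.≟ a′ | φx≡
  ... | yes _ | _       | _      | ()
  ... | no _  | yes _   | _      | ()
  ... | no _  | no _    | no _   | ()
  ... | no _  | no x≢a′ | yes x∈ | refl =
    proj₂ (position-inside (depth-inside≥2 x≢a′ x∈) x∈) , proj₂ (right-leaf-below x∈) , x∈

  φ-surjective : ∀ c → ∃ λ x → φ x ≡ c
  φ-surjective c =
    map₂ code-injective (injective⇒surjective (code ∘ φ) code∘φ-injective enough (code c))
    where
    open Injection (↔⇒↣ (crabV↔Fin {b₁} {b₂} {r}))
      using () renaming (to to code; injective to code-injective)
    code∘φ-injective : Injective _≡_ _≡_ (code ∘ φ)
    code∘φ-injective {x} {y} eq =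
      trans (sym (ψ-φ x)) (trans (cong ψ (code-injective {φ x} {φ y} eq)) (ψ-φ y))
    enough : 2 + (b₁ * r + b₂ * r) ≤ n G
    enough = subst (λ m → 2 + m ≤ n G) (trans (cong (_* r) numLeaves≡) (*-distribʳ-+ r b₁ b₂)) many

  φ-ψ : ∀ c → φ (ψ c) ≡ c
  φ-ψ c = begin
    φ (ψ c)     ≡⟨ cong (φ ∘ ψ) φx≡c ⟨
    φ (ψ (φ x)) ≡⟨ cong φ (ψ-φ x) ⟩
    φ x         ≡⟨ φx≡c ⟩
    c           ∎
    where
    open ≡-Reasoning
    x : V
    x = proj₁ (φ-surjective c)
    φx≡c : φ x ≡ c
    φx≡c = proj₂ (φ-surjective c)

  -- φ x picks one leaf below x; once φ is onto, every leaf below x gives the same leg.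
  φ-leftV : ∀ {x i k} → x ≼ leftLeaf i → 1 + toℕ k ≡ depth x → φ x ≡ leftV i k
  φ-leftV {i = i} {k} x≼ dx = trans (cong φ (sym (≼⇒ancestorAt dx x≼))) (φ-ψ (leftV i k))

  φ-rightV : ∀ {x j k} → x ≼ rightLeaf j → 2 + toℕ k ≡ depth x → φ x ≡ rightV j k
  φ-rightV {j = j} {k} x≼ dx = trans (cong φ (sym (≼⇒ancestorAt dx x≼))) (φ-ψ (rightV j k))

  ψ-leftV : ∀ i k → 1 + toℕ k ≡ depth (ψ (leftV i k)) × ψ (leftV i k) ≼ leftLeaf i
  ψ-leftV i k = φ-leftV⁻¹ (φ-ψ (leftV i k))

  ψ-rightV : ∀ j k → 2 + toℕ k ≡ depth (ψ (rightV j k)) × ψ (rightV j k) ≼ rightLeaf j ×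
                     InBranch (ψ (rightV j k))
  ψ-rightV j k = φ-rightV⁻¹ (φ-ψ (rightV j k))

  crabE⇒⋖ : ∀ {c c′} → CrabE c c′ → ψ c ⋖ ψ c′
  crabE⇒⋖ e-uv                = root-⋖ depth-a′
  crabE⇒⋖ (e-u i k k≡0)       = root-⋖ (trans (sym (proj₁ (ψ-leftV i k))) (cong suc k≡0))
  crabE⇒⋖ (e-v j k k≡0)       = subst (_⋖ ψ (rightV j k)) (proj₂ (proj₂ (ψ-rightV j k)))
                                  (branch-⋖ (trans (sym (proj₁ (ψ-rightV j k))) (cong (2 +_) k≡0)))
  crabE⇒⋖ (e-l i k k′ k′≡1+k) = ≼-⋖ (proj₂ (ψ-leftV i k)) (proj₂ (ψ-leftV i k′))
    (trans (sym (proj₁ (ψ-leftV i k′))) (cong suc (trans k′≡1+k (proj₁ (ψ-leftV i k)))))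
  crabE⇒⋖ (e-r j k k′ k′≡1+k) = ≼-⋖ (proj₁ (proj₂ (ψ-rightV j k))) (proj₁ (proj₂ (ψ-rightV j k′)))
    (trans (sym (proj₁ (ψ-rightV j k′)))
           (cong suc (trans (cong suc k′≡1+k) (proj₁ (ψ-rightV j k)))))

  ⋖-leftV : ∀ {p c i k′} → p ⋖ c → ¬ InBranch c → c ≼ leftLeaf i → 1 + toℕ k′ ≡ depth c →
            CrabE (φ p) (leftV i k′)
  ⋖-leftV {p} {c} {i} {k′} p⋖c@(dc , _) c∉ c≼ dk′ = by-parent (root-or-deep p)
    where
    by-parent : p ≡ a ⊎ 1 ≤ depth p → CrabE (φ p) (leftV i k′)
    by-parent (inj₁ refl) = subst (λ x → CrabE x (leftV i k′)) (sym (φ-ψ u0))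
      (e-u i k′ (suc-injective (trans dk′ (trans dc (cong suc depth-root)))))
    by-parent (inj₂ 1≤dp) = along-leg (position-outside 1≤dp (c∉ ∘ trans (⋖⇒branch≡ p⋖c 1≤dp)))
      where
      along-leg : Σ (Fin r) (λ k → 1 + toℕ k ≡ depth p) → CrabE (φ p) (leftV i k′)
      along-leg (k , dk) =
        subst (λ x → CrabE x (leftV i k′)) (sym (φ-leftV (≼-trans (⋖⇒≼ p⋖c) c≼) dk))
        (e-l i k k′ (suc-injective (trans dk′ (trans dc (cong suc (sym dk))))))

  ⋖-rightV : ∀ {p c j k′} → p ⋖ c → 1 ≤ depth p → InBranch c → c ≼ rightLeaf j →
             2 + toℕ k′ ≡ depth c → CrabE (φ p) (rightV j k′)
  ⋖-rightV {p} {c} {j} {k′} p⋖c@(dc , _) 1≤dp c∈ c≼ dk′ = by-depth (m≤n⇒m<n∨m≡n 1≤dp)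
    where
    p∈ : InBranch p
    p∈ = trans (sym (⋖⇒branch≡ p⋖c 1≤dp)) c∈
    by-depth : 1 < depth p ⊎ 1 ≡ depth p → CrabE (φ p) (rightV j k′)
    by-depth (inj₂ 1≡dp) =
      subst (λ x → CrabE x (rightV j k′)) (trans (sym (φ-ψ v0)) (cong φ (sym p≡a′)))
      (e-v j k′ (suc-injective (suc-injective (trans dk′ (trans dc (cong suc (sym 1≡dp)))))))
      where
      p≡a′ : p ≡ a′
      p≡a′ = depth≡1-inside (sym 1≡dp) p∈
    by-depth (inj₁ 1<dp) = along-leg (position-inside 1<dp p∈)
      where
      along-leg : Σ (Fin r) (λ k → 2 + toℕ k ≡ depth p) → CrabE (φ p) (rightV j k′)
      along-leg (k , dk) =
        subst (λ x → CrabE x (rightV j k′)) (sym (φ-rightV (≼-trans (⋖⇒≼ p⋖c) c≼) dk))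
        (e-r j k k′ (suc-injective (suc-injective (trans dk′ (trans dc (cong suc (sym dk)))))))

  ⋖-outside : ∀ {p c} → p ⋖ c → ¬ InBranch c → CrabE (φ p) (φ c)
  ⋖-outside {p} {c} p⋖c c∉ =
    let i  , c≼  = left-leaf-below (⋖⇒≢root p⋖c) c∉
        k′ , dk′ = position-outside (⋖⇒1≤depth p⋖c) c∉
    in subst (CrabE (φ p)) (sym (φ-leftV c≼ dk′)) (⋖-leftV p⋖c c∉ c≼ dk′)

  ⋖-inside : ∀ {p c} → p ⋖ c → InBranch c → CrabE (φ p) (φ c)
  ⋖-inside {p} {c} p⋖c@(dc , _) c∈ = by-parent (root-or-deep p)
    where
    by-parent : p ≡ a ⊎ 1 ≤ depth p → CrabE (φ p) (φ c)
    by-parent (inj₁ refl) =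
      subst₂ CrabE (sym (φ-ψ u0)) (trans (sym (φ-ψ v0)) (cong φ (sym c≡a′))) e-uv
      where
      c≡a′ : c ≡ a′
      c≡a′ = depth≡1-inside (trans dc (cong suc depth-root)) c∈
    by-parent (inj₂ 1≤dp) =
      let j  , c≼  = right-leaf-below c∈
          k′ , dk′ = position-inside (subst (2 ≤_) (sym dc) (s≤s 1≤dp)) c∈
      in subst (CrabE (φ p)) (sym (φ-rightV c≼ dk′)) (⋖-rightV p⋖c 1≤dp c∈ c≼ dk′)

  ⋖⇒crabE : ∀ {p c} → p ⋖ c → CrabE (φ p) (φ c)
  ⋖⇒crabE {p} {c} p⋖c = by-side (branch c Fin.≟ a′)
    where
    by-side : Dec (InBranch c) → CrabE (φ p) (φ c)
    by-side (yes c∈) = ⋖-inside p⋖c c∈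
    by-side (no  c∉) = ⋖-outside p⋖c c∉

  adj⇒crabAdj : ∀ {x y} → Adj G x y → CrabAdj b₁ b₂ r (φ x) (φ y)
  adj⇒crabAdj xy = Sum.map ⋖⇒crabE ⋖⇒crabE (adj⇒⋖ xy)

  crabAdj⇒adj : ∀ {x y} → CrabAdj b₁ b₂ r (φ x) (φ y) → Adj G x y
  crabAdj⇒adj {x} {y} (inj₁ e) = subst₂ (Adj G) (ψ-φ x) (ψ-φ y) (⋖⇒adj (crabE⇒⋖ e))
  crabAdj⇒adj {x} {y} (inj₂ e) = subst₂ (Adj G) (ψ-φ x) (ψ-φ y) (adj-sym (⋖⇒adj (crabE⇒⋖ e)))

  isoCrab : IsoCrab G b₁ b₂ r
  isoCrab = mk↔ₛ′ φ ψ φ-ψ ψ-φ , λ x y → mk⇔ adj⇒crabAdj crabAdj⇒adj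

  1≤b₁ : 1 ≤ r → 1 ≤ b₁
  1≤b₁ 1≤r = ≤-trans (s≤s z≤n) (Finₚ.toℕ<n (proj₁ (left-leaf-below u≢a u∉)))
    where
    u≢a : u ≢ a
    u≢a refl = contradiction (trans (sym depth-u) depth-root) (m<n⇒n≢0 1≤r)

  1≤b₂ : 1 ≤ b₂
  1≤b₂ = ≤-trans (s≤s z≤n) (Finₚ.toℕ<n (proj₁ (right-leaf-below {v} refl)))

diametral-tree⇒crab : ∀ (T : SimpleGraph) r → 1 ≤ r → IsTree T → Diameter T (r + suc r) →
                      2 + numLeaves T * r ≤ n T →
                      ∃₂ λ b₁ b₂ → 1 ≤ b₁ × 1 ≤ b₂ × numLeaves T ≡ b₁ + b₂ × IsoCrab T b₁ b₂ r
diametral-tree⇒crab T r 1≤r (connected , acyclic) ((u , v , u→v , long) , bounded) many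
  with a , u→a , a→v ← Walks.splitʷ T r u→v =
  b₁ , b₂ , 1≤b₁ 1≤r , 1≤b₂ , numLeaves≡ , isoCrab
  where open CrabShape T connected acyclic r u→a a→v long bounded many

matching-size : ∀ (G : SimpleGraph) {M} → IsMatching G M → 2 * length M ≤ n G
matching-size G {M} (_ , endpoints!) =
  subst (_≤ n G) (length-endpoints M) (Unique⇒length≤ endpoints!)
  where
  length-endpoints : ∀ (M : List (Fin (n G) × Fin (n G))) →
                     length (concatMap (λ e → proj₁ e ∷ proj₂ e ∷ []) M) ≡ 2 * length M
  length-endpoints []      = refl
  length-endpoints (_ ∷ M) = trans (cong (2 +_) (length-endpoints M)) (sym (*-suc 2 (length M)))

4t+1≡2t+[1+2t] : ∀ t → 4 * t + 1 ≡ 2 * t + suc (2 * t)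
4t+1≡2t+[1+2t] = solve 1 (λ t → con 4 :* t :+ con 1 := con 2 :* t :+ (con 1 :+ con 2 :* t)) refl

2[bt+1]≡2+b[2t] : ∀ b t → 2 * (b * t + 1) ≡ 2 + b * (2 * t)
2[bt+1]≡2+b[2t] = solve 2 (λ b t → con 2 :* (b :* t :+ con 1) := con 2 :+ b :* (con 2 :* t)) refl

lemma2p9 : (b t : ℕ) → 2 ≤ b → 1 ≤ t → (T : SimpleGraph) →
    IsTree T → Diameter T (4 * t + 1) → numLeaves T ≡ b →
    MatchingNumber T (b * t + 1) →
    ∃ λ b1 → 1 ≤ b1 × b1 ≤ b ∸ 1 × IsoCrab T b1 (b ∸ b1) (2 * t)
lemma2p9 b t _ 1≤t T tree diameter refl ((M , matching , |M|≡bt+1) , _) =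
  shape (diametral-tree⇒crab T (2 * t) 1≤2t tree
           (subst (Diameter T) (4t+1≡2t+[1+2t] t) diameter) many)
  where
  1≤2t : 1 ≤ 2 * t
  1≤2t = ≤-trans 1≤t (m≤m+n t (t + 0))
  many : 2 + numLeaves T * (2 * t) ≤ n T
  many = subst (_≤ n T) (trans (cong (2 *_) |M|≡bt+1) (2[bt+1]≡2+b[2t] (numLeaves T) t))
               (matching-size T matching)
  shape : ∃₂ (λ b₁ b₂ → 1 ≤ b₁ × 1 ≤ b₂ × numLeaves T ≡ b₁ + b₂ × IsoCrab T b₁ b₂ (2 * t)) →
          ∃ λ b₁ → 1 ≤ b₁ × b₁ ≤ numLeaves T ∸ 1 × IsoCrab T b₁ (numLeaves T ∸ b₁) (2 * t)
  shape (b₁ , b₂ , 1≤b₁ , 1≤b₂ , ℓ≡b₁+b₂ , iso) rewrite ℓ≡b₁+b₂ =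
    b₁ , 1≤b₁ , subst (b₁ ≤_) (sym (+-∸-assoc b₁ 1≤b₂)) (m≤m+n b₁ (b₂ ∸ 1)) ,
    subst (λ b₂′ → IsoCrab T b₁ b₂′ (2 * t)) (sym (m+n∸m≡n b₁ b₂)) iso
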